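{- Let $\ell$ be sufficiently large with $\ell^{0.1}$ an integer, let $v$ be a node with a palette of $p(v)>\ell$ colors from $[n^2]$, and suppose $v$ is assigned a bin $h_1(v)\in\{1,\dots,\ell^{0.1}-1\}$. Let $h_2$ be chosen uniformly at random from a $c$-wise independent family of hash functions $[n^2]\to[\ell^{0.1}-1]$, for a sufficiently large constant $c$, and let $p'(v)$ be the number of colors $\gamma$ in $v$'s palette with $h_2(\gamma)=h_1(v)$. Then the probability that $p'(v)\le p(v)\ell^{ -0.1}+\ell^{0.7}$ is at most $\ell^{ -3}$.
   Context: A family $\mathcal H$ of functions $[N]\to[L]$ is $c$-wise independent if for all distinct $x_1,\dots,x_c\in[N]$, the values $h(x_1),\dots,h(x_c)$ are independent and uniformly distributed in $[L]$ when $h$ is uniform from $\mathcal H$. -}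

module Defs where

open import Data.Nat using (ℕ; _*_; _^_; _≤?_; _∸_)
open import Data.Fin using (Fin; _≟_)
open import Data.Fin.Properties using (all?)
open import Data.Fin.Subset using (Subset; _∈_)
open import Data.Fin.Subset.Properties using (_∈?_)
open import Data.List using (List; length; filter; allFin)
open import Data.Product using (_×_)
open import Relation.Nullary.Decidable using (_×-dec_)
open import Relation.Binary.PropositionalEquality using (_≡_)
open import Function.Definitions using (Injective)

-- A family of hash functions [N] → [L] is a list (multiset) of functions;
-- "h uniform from H" means uniform over list positions.
-- c-wise independence: for all distinct x₁..x_c and all y₁..y_c,
--   Pr[h(xᵢ) = yᵢ ∀ i] = L^{-c},  i.e.  #{h : ∀ i, h(xᵢ)=yᵢ} * L^c = |H|.
CWiseIndependent : (c N L : ℕ) → List (Fin N → Fin L) → Set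
CWiseIndependent c N L H =
  (xs : Fin c → Fin N) → Injective _≡_ _≡_ xs →
  (ys : Fin c → Fin L) →
  length (filter (λ h → all? (λ i → h (xs i) ≟ ys i)) H) * L ^ c ≡ length H

-- p'(v): number of colours γ in palette P with h₂(γ) = b (b = h₁(v)).
binCount : {N L : ℕ} → (Fin N → Fin L) → Subset N → Fin L → ℕ
binCount {N} h P b = length (filter (λ γ → (γ ∈? P) ×-dec (h γ ≟ b)) (allFin N))

module Submission where

-- Let L = m − 1 be the number of bins, p = |P| and p′ the load of bin b. For the centred
-- indicator φ v = L·[v = b] − 1 the sum S h = Σ_{γ ∈ P} φ (h γ) equals L p′ − p, so every bad h
-- (p′ m ≤ p + m⁸) has |S h| ≥ p / 4m, and by Markov's inequality for the 10th moment there are at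
-- most (4m / p)¹⁰ Σ_h (S h)¹⁰ bad h.
--
-- The 10th moment is the same as for a fully random h. A c-wise independent family is uniform on
-- any ≤ c distinct points (sum out the value at a fresh point), so for r < c and γ ∉ Γ the value
-- h γ is uniform and independent of (S_Γ h)^r. Expanding (φ (h γ) + S_Γ h)^r binomially gives
-- L · M_r(γ ∷ Γ) = Σ_k C(r,k) M_{r−k}(Γ) Σ_v φ(v)^k for M_r(Γ) = Σ_h (S_Γ h)^r, and since
-- Σ_v φ v = 0, induction on Γ yields M₁₀ ≤ K₁₀ |H| (p + L)⁵ L⁵. Altogether the bad fraction is at
-- most 4¹⁰ 2⁵ K₁₀ m¹⁵ / p⁵ ≤ m⁻³⁰ once p > m¹⁰ and m is large.

open import Defs
open import Data.Nat as ℕ using (ℕ; zero; suc)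
import Data.Nat.Properties as ℕ
open import Data.Nat.Combinatorics using (_C_)
open import Data.Nat.ListAction using (sum)
open import Data.Integer as ℤ using (ℤ)
import Data.Integer.Properties as ℤ
open import Data.Bool using (if_then_else_)
open import Data.Fin as Fin using (Fin; zero; suc; toℕ; _≟_)
import Data.Fin.Properties as Fin
open import Data.Fin.Subset using (Subset; inside; outside; ∣_∣)
open import Data.Fin.Subset.Properties using (_∈?_; ∣p∣≤n)
open import Data.List using (List; []; _∷_; _++_; map; concatMap; length; filter; allFin; lookup)
open import Data.List.Properties using (map-tabulate; length-tabulate)
open import Data.List.Relation.Unary.All as All using (All; []; _∷_)
open import Data.List.Relation.Unary.All.Properties using (¬Any⇒All¬; concat⁺; map⁺)
open import Data.List.Relation.Unary.AllPairs using (AllPairs; []; _∷_)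
open import Data.List.Relation.Unary.Any as Any using (Any; here; there)
open import Data.List.Relation.Unary.Any.Properties using (lookup-index)
open import Data.List.Relation.Unary.Unique.Propositional using (Unique)
open import Data.List.Relation.Unary.Unique.Propositional.Properties using (filter⁺; allFin⁺)
open import Data.List.Membership.Propositional.Properties using (∈-lookup)
open import Data.Product using (∃; _×_; _,_; proj₁; proj₂)
open import Data.Sum using (_⊎_; inj₁; inj₂)
open import Data.Unit using (tt)
open import Function using (_∘_)
open import Relation.Binary.PropositionalEquality
open import Relation.Nullary using (Dec; yes; no; does; contradiction)
open import Relation.Nullary.Decidable using (_×-dec_)
import Algebra.Definitions.RawMonoid as RawMonoid
import Algebra.Definitions.RawSemiring as RawSemiring
import Algebra.Properties.CommutativeSemiring.Binomial as Binomial

module Sums where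

  open import Data.Integer using (0ℤ; 1ℤ; +_; _+_; _*_; _^_)
  open import Data.Integer.Tactic.RingSolver using (solve-∀)
  open import Algebra.Properties.Monoid.Sum ℤ.+-0-monoid using (sum-cong-≗)

  private variable
    A B : Set

  ∑ : List A → (A → ℤ) → ℤ
  ∑ [] f = 0ℤ
  ∑ (x ∷ xs) f = f x + ∑ xs f

  syntax ∑ xs (λ x → e) = ∑[ x ∈ xs ] e

  ∑-cong : ∀ (xs : List A) {f g : A → ℤ} → (∀ x → f x ≡ g x) → ∑ xs f ≡ ∑ xs g
  ∑-cong [] e = refl
  ∑-cong (x ∷ xs) e = cong₂ _+_ (e x) (∑-cong xs e)

  ∑-congᴬ : ∀ {xs : List A} {f g : A → ℤ} → All (λ x → f x ≡ g x) xs → ∑ xs f ≡ ∑ xs g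
  ∑-congᴬ [] = refl
  ∑-congᴬ (e ∷ es) = cong₂ _+_ e (∑-congᴬ es)

  ∑-distrib-+ : ∀ (xs : List A) (f g : A → ℤ) → ∑[ x ∈ xs ] (f x + g x) ≡ ∑ xs f + ∑ xs g
  ∑-distrib-+ [] f g = refl
  ∑-distrib-+ (x ∷ xs) f g = trans (cong (_+_ (f x + g x)) (∑-distrib-+ xs f g)) (swap (f x) (g x) _ _)
    where
    swap : ∀ a b c d → (a + b) + (c + d) ≡ (a + c) + (b + d)
    swap = solve-∀

  ∑-*ˡ : ∀ (xs : List A) c (f : A → ℤ) → ∑[ x ∈ xs ] (c * f x) ≡ c * ∑ xs f
  ∑-*ˡ [] c f = sym (ℤ.*-zeroʳ c)
  ∑-*ˡ (x ∷ xs) c f = trans (cong (_+_ (c * f x)) (∑-*ˡ xs c f)) (sym (ℤ.*-distribˡ-+ c (f x) (∑ xs f)))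

  ∑-*ʳ : ∀ (xs : List A) c (f : A → ℤ) → ∑[ x ∈ xs ] (f x * c) ≡ ∑ xs f * c
  ∑-*ʳ xs c f = trans (∑-cong xs (λ x → ℤ.*-comm (f x) c)) (trans (∑-*ˡ xs c f) (ℤ.*-comm c (∑ xs f)))

  ∑-zero : ∀ (xs : List A) → ∑[ x ∈ xs ] 0ℤ ≡ 0ℤ
  ∑-zero [] = refl
  ∑-zero (x ∷ xs) = trans (ℤ.+-identityˡ _) (∑-zero xs)

  ∑-const : ∀ (xs : List A) c → ∑[ x ∈ xs ] c ≡ + length xs * c
  ∑-const [] c = sym (ℤ.*-zeroˡ c)
  ∑-const (x ∷ xs) c = trans (cong (_+_ c) (∑-const xs c)) (sym (ℤ.suc-* (+ length xs) c))

  ∑-++ : ∀ (xs ys : List A) (f : A → ℤ) → ∑ (xs ++ ys) f ≡ ∑ xs f + ∑ ys f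
  ∑-++ [] ys f = sym (ℤ.+-identityˡ (∑ ys f))
  ∑-++ (x ∷ xs) ys f = trans (cong (_+_ (f x)) (∑-++ xs ys f)) (sym (ℤ.+-assoc (f x) _ _))

  ∑-map : ∀ (g : A → B) (xs : List A) (f : B → ℤ) → ∑ (map g xs) f ≡ ∑ xs (f ∘ g)
  ∑-map g [] f = refl
  ∑-map g (x ∷ xs) f = cong (_+_ (f (g x))) (∑-map g xs f)

  ∑-concatMap : ∀ (g : A → List B) (xs : List A) (f : B → ℤ) →
    ∑ (concatMap g xs) f ≡ ∑[ x ∈ xs ] ∑ (g x) f
  ∑-concatMap g [] f = refl
  ∑-concatMap g (x ∷ xs) f = trans (∑-++ (g x) _ f) (cong (_+_ (∑ (g x) f)) (∑-concatMap g xs f))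

  ∑-comm : ∀ (xs : List A) (ys : List B) (f : A → B → ℤ) →
    ∑[ x ∈ xs ] ∑ ys (f x) ≡ ∑[ y ∈ ys ] ∑[ x ∈ xs ] f x y
  ∑-comm [] ys f = sym (∑-zero ys)
  ∑-comm (x ∷ xs) ys f = trans (cong (_+_ (∑ ys (f x))) (∑-comm xs ys f))
                               (sym (∑-distrib-+ ys (f x) (λ y → ∑[ x ∈ xs ] f x y)))

  ∑-allFin-suc : ∀ n (f : Fin (suc n) → ℤ) → ∑ (allFin (suc n)) f ≡ f zero + ∑[ i ∈ allFin n ] f (suc i)
  ∑-allFin-suc n f =
    cong (_+_ (f zero)) (trans (cong (λ l → ∑ l f) (sym (map-tabulate (λ i → i) suc))) (∑-map suc (allFin n) f))

  ∏ : List A → (A → ℤ) → ℤ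
  ∏ [] f = 1ℤ
  ∏ (x ∷ xs) f = f x * ∏ xs f

  ∏-distrib-* : ∀ (xs : List A) (f g : A → ℤ) → ∏ xs (λ x → f x * g x) ≡ ∏ xs f * ∏ xs g
  ∏-distrib-* [] f g = refl
  ∏-distrib-* (x ∷ xs) f g = trans (cong ((f x * g x) *_) (∏-distrib-* xs f g)) (swap (f x) (g x) _ _)
    where
    swap : ∀ a b c d → (a * b) * (c * d) ≡ (a * c) * (b * d)
    swap = solve-∀

  tuples : ℕ → List A → List (List A)
  tuples zero xs = [] ∷ []
  tuples (suc n) xs = concatMap (λ x → map (x ∷_) (tuples n xs)) xs

  ∑-^ : ∀ n (xs : List A) (f : A → ℤ) → ∑ xs f ^ n ≡ ∑[ t ∈ tuples n xs ] ∏ t f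
  ∑-^ zero xs f = refl
  ∑-^ (suc n) xs f = begin
    ∑ xs f * ∑ xs f ^ n                                  ≡⟨ cong (∑ xs f *_) (∑-^ n xs f) ⟩
    ∑ xs f * T                                           ≡⟨ sym (∑-*ʳ xs T f) ⟩
    ∑[ x ∈ xs ] (f x * T)                                ≡⟨ ∑-cong xs prepend ⟩
    ∑[ x ∈ xs ] ∑[ t ∈ map (x ∷_) (tuples n xs) ] ∏ t f  ≡⟨ sym (∑-concatMap _ xs _) ⟩
    ∑[ t ∈ tuples (suc n) xs ] ∏ t f                     ∎
    where
    open ≡-Reasoning
    T = ∑[ t ∈ tuples n xs ] ∏ t f
    prepend : ∀ x → f x * T ≡ ∑[ t ∈ map (x ∷_) (tuples n xs) ] ∏ t f
    prepend x = sym (trans (∑-map (x ∷_) (tuples n xs) _) (∑-*ˡ (tuples n xs) (f x) _))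

  tuples-All : ∀ {P : A → Set} n (xs : List A) → All P xs → All (λ t → All P t × length t ≡ n) (tuples n xs)
  tuples-All zero xs _ = ([] , refl) ∷ []
  tuples-All (suc n) xs pxs =
    concat⁺ (map⁺ (All.map (λ px → map⁺ (All.map (λ (pt , len) → px ∷ pt , cong suc len) (tuples-All n xs pxs))) pxs))

  open RawMonoid ℤ.+-0-rawMonoid public using () renaming (sum to ∑ᶻ; _×_ to _×ᶻ_)
  private
    module Exp = RawSemiring ℤ.+-*-rawSemiring

  ∑-∑ᶻ-comm : ∀ (xs : List A) n (f : A → Fin n → ℤ) → ∑[ x ∈ xs ] ∑ᶻ (f x) ≡ ∑ᶻ (λ k → ∑[ x ∈ xs ] f x k)
  ∑-∑ᶻ-comm xs zero f = ∑-zero xs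
  ∑-∑ᶻ-comm xs (suc n) f =
    trans (∑-distrib-+ xs _ _) (cong (_+_ (∑[ x ∈ xs ] f x zero)) (∑-∑ᶻ-comm xs n (λ x k → f x (suc k))))

  ^≡Exp^ : ∀ (x : ℤ) n → x ^ n ≡ x Exp.^ n
  ^≡Exp^ x zero = refl
  ^≡Exp^ x (suc n) = cong (x *_) (^≡Exp^ x n)

  ×ᶻ≡* : ∀ n (x : ℤ) → n ×ᶻ x ≡ + n * x
  ×ᶻ≡* zero x = sym (ℤ.*-zeroˡ x)
  ×ᶻ≡* (suc n) x = trans (cong (_+_ x) (×ᶻ≡* n x)) (sym (ℤ.suc-* (+ n) x))

  binomial : ∀ r (x y : ℤ) →
    (x + y) ^ r ≡ ∑ᶻ (λ (k : Fin (suc r)) → + (r C toℕ k) * (x ^ toℕ k * y ^ (r ℕ.∸ toℕ k)))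
  binomial r x y = begin
    (x + y) ^ r                                                ≡⟨ ^≡Exp^ (x + y) r ⟩
    (x + y) Exp.^ r                                            ≡⟨ Binomial.theorem ℤ.+-*-commutativeSemiring r x y ⟩
    Binomial.binomialExpansion ℤ.+-*-commutativeSemiring x y r ≡⟨ sum-cong-≗ {suc r} term ⟩
    ∑ᶻ (λ (k : Fin (suc r)) → + (r C toℕ k) * (x ^ toℕ k * y ^ (r ℕ.∸ toℕ k))) ∎
    where
    open ≡-Reasoning
    term : ∀ k → (r C toℕ k) ×ᶻ (x Exp.^ toℕ k * y Exp.^ (r ℕ.∸ toℕ k))
               ≡ + (r C toℕ k) * (x ^ toℕ k * y ^ (r ℕ.∸ toℕ k))
    term k = trans (×ᶻ≡* (r C toℕ k) _)
                   (cong (+ (r C toℕ k) *_) (sym (cong₂ _*_ (^≡Exp^ x (toℕ k)) (^≡Exp^ y (r ℕ.∸ toℕ k)))))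

open Sums

module Indicators where

  open import Data.Integer using (0ℤ; 1ℤ; +_; _+_; _-_; _*_)
  open import Data.Vec using ([]; _∷_)
  open import Data.Integer.Tactic.RingSolver using (solve-∀)

  private variable
    A : Set

  𝟙 : {P : Set} → Dec P → ℤ
  𝟙 d = if does d then 1ℤ else 0ℤ

  𝟙-×-dec : {P Q : Set} (p : Dec P) (q : Dec Q) → 𝟙 (p ×-dec q) ≡ 𝟙 p * 𝟙 q
  𝟙-×-dec (yes _) q = sym (ℤ.*-identityˡ (𝟙 q))
  𝟙-×-dec (no _) q = refl

  𝟙-affine : {P : Set} (g : ℤ → ℤ) (d : Dec P) → g (𝟙 d) ≡ 𝟙 d * (g 1ℤ - g 0ℤ) + g 0ℤ
  𝟙-affine g (yes _) = at-one (g 1ℤ) (g 0ℤ)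
    where
    at-one : ∀ a z → a ≡ 1ℤ * (a - z) + z
    at-one = solve-∀
  𝟙-affine g (no _) = at-zero (g 1ℤ) (g 0ℤ)
    where
    at-zero : ∀ a z → z ≡ 0ℤ * (a - z) + z
    at-zero = solve-∀

  length-filter≡∑𝟙 : ∀ {P : A → Set} (P? : ∀ x → Dec (P x)) (xs : List A) →
    + length (filter P? xs) ≡ ∑[ x ∈ xs ] 𝟙 (P? x)
  length-filter≡∑𝟙 P? [] = refl
  length-filter≡∑𝟙 P? (x ∷ xs) with P? x
  ... | yes _ = trans (ℤ.pos-+ 1 _) (cong (_+_ 1ℤ) (length-filter≡∑𝟙 P? xs))
  ... | no _ = trans (length-filter≡∑𝟙 P? xs) (sym (ℤ.+-identityˡ _))

  ∑-filter : ∀ {P : A → Set} (P? : ∀ x → Dec (P x)) (xs : List A) (f : A → ℤ) →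
    ∑ (filter P? xs) f ≡ ∑[ x ∈ xs ] (𝟙 (P? x) * f x)
  ∑-filter P? [] f = refl
  ∑-filter P? (x ∷ xs) f with P? x
  ... | yes _ = cong₂ _+_ (sym (ℤ.*-identityˡ (f x))) (∑-filter P? xs f)
  ... | no _ = trans (∑-filter P? xs f) (sym (ℤ.+-identityˡ _))

  ∣p∣≡∑𝟙∈ : ∀ {n} (p : Subset n) → + ∣ p ∣ ≡ ∑[ x ∈ allFin n ] 𝟙 (x ∈? p)
  ∣p∣≡∑𝟙∈ [] = refl
  ∣p∣≡∑𝟙∈ {suc n} (inside ∷ p) =
    trans (cong (_+_ 1ℤ) (∣p∣≡∑𝟙∈ p)) (sym (∑-allFin-suc n (λ x → 𝟙 (x ∈? inside ∷ p))))
  ∣p∣≡∑𝟙∈ {suc n} (outside ∷ p) =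
    trans (trans (∣p∣≡∑𝟙∈ p) (sym (ℤ.+-identityˡ _))) (sym (∑-allFin-suc n (λ x → 𝟙 (x ∈? outside ∷ p))))

  δ : ∀ {n} → Fin n → Fin n → ℤ
  δ a b = 𝟙 (a ≟ b)

  δ-sym : ∀ {n} (a b : Fin n) → δ a b ≡ δ b a
  δ-sym a b with a ≟ b | b ≟ a
  ... | yes _ | yes _ = refl
  ... | no _ | no _ = refl
  ... | yes a≡b | no b≢a = contradiction (sym a≡b) b≢a
  ... | no a≢b | yes b≡a = contradiction (sym b≡a) a≢b

  δ-idem : ∀ {n} (a b : Fin n) → δ a b * δ a b ≡ δ a b
  δ-idem a b with a ≟ b
  ... | yes _ = refl
  ... | no _ = refl

  δ-orth : ∀ {n} (a : Fin n) {v w} → v ≢ w → δ a v * δ a w ≡ 0ℤ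
  δ-orth a {v} {w} v≢w with a ≟ v | a ≟ w
  ... | yes refl | yes refl = contradiction refl v≢w
  ... | yes _ | no _ = refl
  ... | no _ | _ = refl

  ∑-δ : ∀ {n} (a : Fin n) (g : Fin n → ℤ) → ∑[ y ∈ allFin n ] (δ a y * g y) ≡ g a
  ∑-δ {suc n} zero g = begin
    ∑[ y ∈ allFin (suc n) ] (δ zero y * g y)           ≡⟨ ∑-allFin-suc n (λ y → δ zero y * g y) ⟩
    1ℤ * g zero + ∑[ i ∈ allFin n ] (0ℤ * g (suc i))   ≡⟨ cong₂ _+_ (ℤ.*-identityˡ (g zero)) rest≡0 ⟩
    g zero + 0ℤ                                        ≡⟨ ℤ.+-identityʳ (g zero) ⟩
    g zero                                             ∎
    where
    open ≡-Reasoning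
    rest≡0 = trans (∑-cong (allFin n) (λ i → ℤ.*-zeroˡ (g (suc i)))) (∑-zero (allFin n))
  ∑-δ {suc n} (suc a) g = begin
    ∑[ y ∈ allFin (suc n) ] (δ (suc a) y * g y)          ≡⟨ ∑-allFin-suc n (λ y → δ (suc a) y * g y) ⟩
    0ℤ * g zero + ∑[ i ∈ allFin n ] (δ a i * g (suc i))  ≡⟨ cong₂ _+_ (ℤ.*-zeroˡ (g zero)) (∑-δ a (g ∘ suc)) ⟩
    0ℤ + g (suc a)                                       ≡⟨ ℤ.+-identityˡ (g (suc a)) ⟩
    g (suc a)                                            ∎
    where open ≡-Reasoning

  ∑-∘δ : ∀ {n} (b : Fin (suc n)) (g : ℤ → ℤ) → ∑[ v ∈ allFin (suc n) ] g (δ v b) ≡ g 1ℤ + + n * g 0ℤ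
  ∑-∘δ {n} b g = begin
    ∑[ v ∈ allFin (suc n) ] g (δ v b)
      ≡⟨ ∑-cong (allFin (suc n)) affine ⟩
    ∑[ v ∈ allFin (suc n) ] (δ b v * (g 1ℤ - g 0ℤ) + g 0ℤ)
      ≡⟨ ∑-distrib-+ (allFin (suc n)) (λ v → δ b v * (g 1ℤ - g 0ℤ)) (λ _ → g 0ℤ) ⟩
    ∑[ v ∈ allFin (suc n) ] (δ b v * (g 1ℤ - g 0ℤ)) + ∑[ v ∈ allFin (suc n) ] g 0ℤ
      ≡⟨ cong₂ _+_ (∑-δ b (λ _ → g 1ℤ - g 0ℤ)) (∑-const (allFin (suc n)) (g 0ℤ)) ⟩
    (g 1ℤ - g 0ℤ) + + length (allFin (suc n)) * g 0ℤ
      ≡⟨ cong (λ k → (g 1ℤ - g 0ℤ) + + k * g 0ℤ) (length-tabulate {n = suc n} (λ i → i)) ⟩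
    (g 1ℤ - g 0ℤ) + (1ℤ + + n) * g 0ℤ
      ≡⟨ cancel (g 1ℤ) (g 0ℤ) (+ n) ⟩
    g 1ℤ + + n * g 0ℤ ∎
    where
    open ≡-Reasoning
    affine : ∀ v → g (δ v b) ≡ δ b v * (g 1ℤ - g 0ℤ) + g 0ℤ
    affine v = trans (𝟙-affine g (v ≟ b)) (cong (λ d → d * (g 1ℤ - g 0ℤ) + g 0ℤ) (δ-sym v b))
    cancel : ∀ a z x → (a - z) + (1ℤ + x) * z ≡ a + x * z
    cancel = solve-∀

open Indicators

module Constraints (N L : ℕ) where

  open import Data.Integer using (0ℤ; _*_)
  open import Data.Integer.Tactic.RingSolver using (solve-∀)
  open import Data.Nat using (_≤_; _<_)

  Hash : Set
  Hash = Fin N → Fin L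

  Constraints : Set
  Constraints = List (Fin N × Fin L)

  χ : Constraints → Hash → ℤ
  χ cs h = ∏ cs (λ (x , v) → δ (h x) v)

  Fresh : Fin N → Constraints → Set
  Fresh z = All (λ q → z ≢ proj₁ q)

  Distinct : Constraints → Set
  Distinct = AllPairs (λ p q → proj₁ p ≢ proj₁ q)

  fresh-exists : ∀ cs → length cs < N → ∃ λ z → Fresh z cs
  fresh-exists cs |cs|<N with Fin.all? (λ z → Any.any? (λ q → z ≟ proj₁ q) cs)
  ... | yes allUsed = contradiction (Fin.injective⇒≤ index-injective) (ℕ.<⇒≱ |cs|<N)
    where
    index-injective : ∀ {z₁ z₂} → Any.index (allUsed z₁) ≡ Any.index (allUsed z₂) → z₁ ≡ z₂
    index-injective {z₁} {z₂} eq = trans (lookup-index (allUsed z₁))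
      (trans (cong (λ j → proj₁ (lookup cs j)) eq) (sym (lookup-index (allUsed z₂))))
  ... | no ¬allUsed with Fin.¬∀⟶∃¬ N _ (λ z → Any.any? (λ q → z ≟ proj₁ q) cs) ¬allUsed
  ...   | z , unused = z , ¬Any⇒All¬ cs unused

  lookup-injective : ∀ {cs} → Distinct cs → ∀ {i j} → proj₁ (lookup cs i) ≡ proj₁ (lookup cs j) → i ≡ j
  lookup-injective (fr ∷ d) {zero} {zero} eq = refl
  lookup-injective (fr ∷ d) {zero} {suc j} eq = contradiction eq (All.lookup fr (∈-lookup j))
  lookup-injective (fr ∷ d) {suc i} {zero} eq = contradiction (sym eq) (All.lookup fr (∈-lookup i))
  lookup-injective (fr ∷ d) {suc i} {suc j} eq = cong suc (lookup-injective d eq)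

  satisfies? : (cs : Constraints) (h : Hash) → Dec (∀ i → h (proj₁ (lookup cs i)) ≡ proj₂ (lookup cs i))
  satisfies? cs h = Fin.all? (λ i → h (proj₁ (lookup cs i)) ≟ proj₂ (lookup cs i))

  χ≡𝟙-satisfies? : ∀ cs h → 𝟙 (satisfies? cs h) ≡ χ cs h
  χ≡𝟙-satisfies? [] h = refl
  χ≡𝟙-satisfies? ((x , v) ∷ cs) h =
    trans (𝟙-×-dec (h x ≟ v) (satisfies? cs h)) (cong (δ (h x) v *_) (χ≡𝟙-satisfies? cs h))

  χ-absorbs : ∀ {cs x} → Any (λ q → proj₁ q ≡ x) cs → ∃ λ w → ∀ h → χ cs h ≡ δ (h x) w * χ cs h
  χ-absorbs {(x , w) ∷ cs} (here refl) = w , λ h →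
    sym (trans (sym (ℤ.*-assoc (δ (h x) w) _ _)) (cong (_* χ cs h) (δ-idem (h x) w)))
  χ-absorbs {(y , v) ∷ cs} {x} (there x∈cs) with χ-absorbs x∈cs
  ... | w , absorbs = w , λ h →
    trans (cong (δ (h y) v *_) (absorbs h)) (exchange (δ (h y) v) (δ (h x) w) (χ cs h))
    where
    exchange : ∀ a b c → a * (b * c) ≡ b * (a * c)
    exchange = solve-∀

  record Reduct (cs : Constraints) : Set where
    field
      reduct : Constraints
      distinct : Distinct reduct
      fresh : ∀ {z} → Fresh z cs → Fresh z reduct
      shorter : length reduct ≤ length cs
      χ-reduct : ∀ h → χ cs h ≡ χ reduct h

  open Reduct

  normalise : ∀ cs → (∀ h → χ cs h ≡ 0ℤ) ⊎ Reduct cs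
  normalise [] = inj₂ record
    { reduct = [] ; distinct = [] ; fresh = λ _ → [] ; shorter = ℕ.z≤n ; χ-reduct = λ h → refl }
  normalise ((x , v) ∷ cs) with normalise cs
  ... | inj₁ χ≡0 = inj₁ (λ h → trans (cong (δ (h x) v *_) (χ≡0 h)) (ℤ.*-zeroʳ (δ (h x) v)))
  ... | inj₂ r with Any.any? (λ q → proj₁ q ≟ x) (reduct r)
  ...   | no x∉r = inj₂ record
          { reduct = (x , v) ∷ reduct r
          ; distinct = All.map (λ ne → ne ∘ sym) (¬Any⇒All¬ (reduct r) x∉r) ∷ distinct r
          ; fresh = λ { (z≢x ∷ fr) → z≢x ∷ fresh r fr }
          ; shorter = ℕ.s≤s (shorter r)
          ; χ-reduct = λ h → cong (δ (h x) v *_) (χ-reduct r h)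
          }
  ...   | yes x∈r with χ-absorbs x∈r
  ...     | w , absorbs with v ≟ w
  ...       | yes refl = inj₂ record
              { reduct = reduct r
              ; distinct = distinct r
              ; fresh = λ fr → fresh r (All.tail fr)
              ; shorter = ℕ.m≤n⇒m≤1+n (shorter r)
              ; χ-reduct = λ h → trans (cong (δ (h x) v *_) (χ-reduct r h)) (sym (absorbs h))
              }
  ...       | no v≢w = inj₁ λ h → begin
              δ (h x) v * χ cs h                      ≡⟨ cong (δ (h x) v *_) (trans (χ-reduct r h) (absorbs h)) ⟩
              δ (h x) v * (δ (h x) w * χ (reduct r) h) ≡⟨ sym (ℤ.*-assoc (δ (h x) v) _ _) ⟩
              δ (h x) v * δ (h x) w * χ (reduct r) h   ≡⟨ cong (_* χ (reduct r) h) (δ-orth (h x) v≢w) ⟩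
              0ℤ * χ (reduct r) h                      ≡⟨ ℤ.*-zeroˡ (χ (reduct r) h) ⟩
              0ℤ                                       ∎
    where open ≡-Reasoning

module Independence (N L : ℕ) .{{_ : ℕ.NonZero L}} (H : List (Fin N → Fin L))
                    (c : ℕ) (cw : CWiseIndependent c N L H) (c≤N : c ℕ.≤ N) where

  open import Data.Integer using (0ℤ; +_; _*_; _^_)
  open import Data.Integer.Tactic.RingSolver using (solve-∀)
  open import Data.Nat using (_≤_; _<_; _∸_)
  open import Algebra.Properties.Monoid.Sum ℤ.+-0-monoid using (sum-cong-≗)
  open import Algebra.Properties.Semiring.Sum ℤ.+-*-semiring using (*-distribˡ-sum)

  open Constraints N L public
  open Reduct

  mass : Constraints → ℤ
  mass cs = ∑[ h ∈ H ] χ cs h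

  Uniform : Constraints → Set
  Uniform cs = + (L ℕ.^ length cs) * mass cs ≡ + length H

  uniform-at-c : ∀ ds → Distinct ds → length ds ≡ c → Uniform ds
  uniform-at-c ds d refl = begin
    + Lᶜ * mass ds       ≡⟨ cong (+ Lᶜ *_) (sym count≡mass) ⟩
    + Lᶜ * + count       ≡⟨ ℤ.*-comm (+ Lᶜ) (+ count) ⟩
    + count * + Lᶜ       ≡⟨ sym (ℤ.pos-* count Lᶜ) ⟩
    + (count ℕ.* Lᶜ)     ≡⟨ cong +_ (cw xs (lookup-injective d) ys) ⟩
    + length H           ∎
    where
    open ≡-Reasoning
    Lᶜ = L ℕ.^ length ds
    xs : Fin (length ds) → Fin N
    xs i = proj₁ (lookup ds i)
    ys : Fin (length ds) → Fin L
    ys i = proj₂ (lookup ds i)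
    count = length (filter (λ h → satisfies? ds h) H)
    count≡mass : + count ≡ mass ds
    count≡mass = trans (length-filter≡∑𝟙 _ H) (∑-cong H (χ≡𝟙-satisfies? ds))

  mass-split : ∀ z cs → mass cs ≡ ∑[ y ∈ allFin L ] mass ((z , y) ∷ cs)
  mass-split z cs = trans (∑-cong H (λ h → sym (∑-δ (h z) (λ _ → χ cs h))))
                          (∑-comm H (allFin L) (λ h y → δ (h z) y * χ cs h))

  uniform-below : ∀ t ds → Distinct ds → length ds ℕ.+ t ≡ c → Uniform ds
  uniform-below zero ds d eq = uniform-at-c ds d (trans (sym (ℕ.+-identityʳ _)) eq)
  uniform-below (suc t) ds d eq with fresh-exists ds |ds|<N
    where
    |ds|<N : length ds < N
    |ds|<N = ℕ.<-≤-trans (subst (length ds <_) eq (ℕ.m<m+n (length ds) ℕ.z<s)) c≤N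
  ... | z , fz = ℤ.*-cancelˡ-≡ (+ L) _ _ (begin
    + L * (+ Lᵏ * mass ds)
      ≡⟨ sym (ℤ.*-assoc (+ L) (+ Lᵏ) _) ⟩
    + L * + Lᵏ * mass ds
      ≡⟨ cong₂ _*_ (sym (ℤ.pos-* L Lᵏ)) (mass-split z ds) ⟩
    + (L ℕ.* Lᵏ) * ∑[ y ∈ allFin L ] mass ((z , y) ∷ ds)
      ≡⟨ sym (∑-*ˡ (allFin L) (+ (L ℕ.* Lᵏ)) (λ y → mass ((z , y) ∷ ds))) ⟩
    ∑[ y ∈ allFin L ] (+ (L ℕ.* Lᵏ) * mass ((z , y) ∷ ds))
      ≡⟨ ∑-cong (allFin L) extended ⟩
    ∑[ y ∈ allFin L ] (+ length H)
      ≡⟨ ∑-const (allFin L) (+ length H) ⟩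
    + length (allFin L) * + length H
      ≡⟨ cong (λ n → + n * + length H) (length-tabulate {n = L} (λ i → i)) ⟩
    + L * + length H ∎)
    where
    open ≡-Reasoning
    Lᵏ = L ℕ.^ length ds
    extended : ∀ y → Uniform ((z , y) ∷ ds)
    extended y = uniform-below t ((z , y) ∷ ds) (fz ∷ d)
                               (trans (sym (ℕ.+-suc (length ds) t)) eq)

  uniform : ∀ ds → Distinct ds → length ds ≤ c → Uniform ds
  uniform ds d |ds|≤c = uniform-below (c ℕ.∸ length ds) ds d (ℕ.m+[n∸m]≡n |ds|≤c)

  uniform-step : ∀ {z ds} → Distinct ds → Fresh z ds → length ds < c → ∀ y →
                 + L * mass ((z , y) ∷ ds) ≡ mass ds
  uniform-step {z} {ds} d fz |ds|<c y = ℤ.*-cancelˡ-≡ (+ Lᵏ) _ _ {{ℕ.m^n≢0 L (length ds)}} (begin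
    + Lᵏ * (+ L * mass ((z , y) ∷ ds))
      ≡⟨ sym (ℤ.*-assoc (+ Lᵏ) (+ L) _) ⟩
    + Lᵏ * + L * mass ((z , y) ∷ ds)
      ≡⟨ cong (_* mass ((z , y) ∷ ds)) (trans (ℤ.*-comm (+ Lᵏ) (+ L)) (sym (ℤ.pos-* L Lᵏ))) ⟩
    + (L ℕ.* Lᵏ) * mass ((z , y) ∷ ds)
      ≡⟨ uniform ((z , y) ∷ ds) (fz ∷ d) |ds|<c ⟩
    + length H
      ≡⟨ sym (uniform ds d (ℕ.<⇒≤ |ds|<c)) ⟩
    + Lᵏ * mass ds ∎)
    where
    open ≡-Reasoning
    Lᵏ = L ℕ.^ length ds

  fresh-value-uniform : ∀ cs → length cs < c → ∀ {z} → Fresh z cs → ∀ y → + L * mass ((z , y) ∷ cs) ≡ mass cs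
  fresh-value-uniform cs |cs|<c {z} fz y with normalise cs
  ... | inj₁ χ≡0 = trans (cong (+ L *_) (mass≡0 ((z , y) ∷ cs) extended≡0)) (trans (ℤ.*-zeroʳ (+ L)) (sym (mass≡0 cs χ≡0)))
    where
    mass≡0 : ∀ ds → (∀ h → χ ds h ≡ 0ℤ) → mass ds ≡ 0ℤ
    mass≡0 ds χ≡0 = trans (∑-cong H χ≡0) (∑-zero H)
    extended≡0 : ∀ h → χ ((z , y) ∷ cs) h ≡ 0ℤ
    extended≡0 h = trans (cong (δ (h z) y *_) (χ≡0 h)) (ℤ.*-zeroʳ (δ (h z) y))
  ... | inj₂ r = begin
    + L * mass ((z , y) ∷ cs)         ≡⟨ cong (+ L *_) (∑-cong H (λ h → cong (δ (h z) y *_) (χ-reduct r h))) ⟩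
    + L * mass ((z , y) ∷ reduct r)   ≡⟨ uniform-step (distinct r) (fresh r fz) (ℕ.≤-<-trans (shorter r) |cs|<c) y ⟩
    mass (reduct r)                   ≡⟨ ∑-cong H (λ h → sym (χ-reduct r h)) ⟩
    mass cs                           ∎
    where open ≡-Reasoning

  pairs : List (Fin N) → Constraints
  pairs = concatMap (λ x → map (x ,_) (allFin L))

  pairs-fresh : ∀ {γ Γ} → All (γ ≢_) Γ → Fresh γ (pairs Γ)
  pairs-fresh γ∉Γ = concat⁺ (map⁺ (All.map (λ γ≢x → map⁺ (All.universal (λ _ → γ≢x) (allFin L))) γ∉Γ))

  ∑-by-value : ∀ (f : Hash → ℤ) z (ψ : Fin L → ℤ) →
    ∑[ h ∈ H ] (f h * ψ (h z)) ≡ ∑[ y ∈ allFin L ] (ψ y * ∑[ h ∈ H ] (δ (h z) y * f h))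
  ∑-by-value f z ψ = begin
    ∑[ h ∈ H ] (f h * ψ (h z))
      ≡⟨ ∑-cong H (λ h → cong (f h *_) (sym (∑-δ (h z) ψ))) ⟩
    ∑[ h ∈ H ] (f h * ∑[ y ∈ allFin L ] (δ (h z) y * ψ y))
      ≡⟨ ∑-cong H (λ h → sym (∑-*ˡ (allFin L) (f h) _)) ⟩
    ∑[ h ∈ H ] ∑[ y ∈ allFin L ] (f h * (δ (h z) y * ψ y))
      ≡⟨ ∑-comm H (allFin L) _ ⟩
    ∑[ y ∈ allFin L ] ∑[ h ∈ H ] (f h * (δ (h z) y * ψ y))
      ≡⟨ ∑-cong (allFin L) (λ y → trans (∑-cong H (λ h → rearrange (f h) (δ (h z) y) (ψ y))) (∑-*ˡ H (ψ y) _)) ⟩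
    ∑[ y ∈ allFin L ] (ψ y * ∑[ h ∈ H ] (δ (h z) y * f h)) ∎
    where
    open ≡-Reasoning
    rearrange : ∀ a b c → a * (b * c) ≡ c * (b * a)
    rearrange = solve-∀

  fresh-point-factorises : ∀ t → length t < c → ∀ {γ} → Fresh γ t → (ψ : Fin L → ℤ) →
    + L * ∑[ h ∈ H ] (χ t h * ψ (h γ)) ≡ mass t * ∑ (allFin L) ψ
  fresh-point-factorises t |t|<c {γ} fγ ψ = begin
    + L * ∑[ h ∈ H ] (χ t h * ψ (h γ))
      ≡⟨ cong (+ L *_) (∑-by-value (χ t) γ ψ) ⟩
    + L * ∑[ y ∈ allFin L ] (ψ y * mass ((γ , y) ∷ t))
      ≡⟨ sym (∑-*ˡ (allFin L) (+ L) _) ⟩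
    ∑[ y ∈ allFin L ] (+ L * (ψ y * mass ((γ , y) ∷ t)))
      ≡⟨ ∑-cong (allFin L) (λ y → trans (exchange (+ L) (ψ y) _) (cong (ψ y *_) (fresh-value-uniform t |t|<c fγ y))) ⟩
    ∑[ y ∈ allFin L ] (ψ y * mass t)
      ≡⟨ ∑-*ʳ (allFin L) (mass t) ψ ⟩
    ∑ (allFin L) ψ * mass t
      ≡⟨ ℤ.*-comm _ (mass t) ⟩
    mass t * ∑ (allFin L) ψ ∎
    where
    open ≡-Reasoning
    exchange : ∀ a b c → a * (b * c) ≡ b * (a * c)
    exchange = solve-∀

  module Moments (φ : Fin L → ℤ) where

    S : List (Fin N) → Hash → ℤ
    S Γ h = ∑[ x ∈ Γ ] φ (h x)

    weight : Constraints → ℤ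
    weight t = ∏ t (λ (_ , v) → φ v)

    S≡∑pairs : ∀ Γ h → S Γ h ≡ ∑ (pairs Γ) (λ (x , v) → δ (h x) v * φ v)
    S≡∑pairs Γ h = sym (trans (∑-concatMap _ Γ _) (∑-cong Γ (λ x →
      trans (∑-map (x ,_) (allFin L) _) (∑-δ (h x) φ))))

    S^≡∑tuples : ∀ a Γ h → S Γ h ^ a ≡ ∑[ t ∈ tuples a (pairs Γ) ] (χ t h * weight t)
    S^≡∑tuples a Γ h = trans (cong (_^ a) (S≡∑pairs Γ h))
                      (trans (∑-^ a (pairs Γ) _) (∑-cong (tuples a (pairs Γ)) (λ t → ∏-distrib-* t _ _)))

    moment : ℕ → List (Fin N) → ℤ
    moment a Γ = ∑[ h ∈ H ] (S Γ h ^ a)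

    moment≡∑tuples : ∀ a Γ → moment a Γ ≡ ∑[ t ∈ tuples a (pairs Γ) ] (weight t * mass t)
    moment≡∑tuples a Γ = begin
      moment a Γ                               ≡⟨ ∑-cong H (S^≡∑tuples a Γ) ⟩
      ∑[ h ∈ H ] ∑[ t ∈ T ] (χ t h * weight t)  ≡⟨ ∑-comm H T _ ⟩
      ∑[ t ∈ T ] ∑[ h ∈ H ] (χ t h * weight t)  ≡⟨ ∑-cong T (λ t → ∑-*ʳ H (weight t) (χ t)) ⟩
      ∑[ t ∈ T ] (mass t * weight t)            ≡⟨ ∑-cong T (λ t → ℤ.*-comm (mass t) (weight t)) ⟩
      ∑[ t ∈ T ] (weight t * mass t)            ∎
      where
      open ≡-Reasoning
      T = tuples a (pairs Γ)

    moment-factorises : ∀ a → a < c → ∀ {γ Γ} → All (γ ≢_) Γ → (ψ : Fin L → ℤ) →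
      + L * ∑[ h ∈ H ] (S Γ h ^ a * ψ (h γ)) ≡ moment a Γ * ∑ (allFin L) ψ
    moment-factorises a a<c {γ} {Γ} γ∉Γ ψ = begin
      + L * ∑[ h ∈ H ] (S Γ h ^ a * ψ (h γ))
        ≡⟨ cong (+ L *_) (∑-cong H (λ h → trans (cong (_* ψ (h γ)) (S^≡∑tuples a Γ h)) (sym (∑-*ʳ T (ψ (h γ)) _)))) ⟩
      + L * ∑[ h ∈ H ] ∑[ t ∈ T ] (χ t h * weight t * ψ (h γ))
        ≡⟨ cong (+ L *_) (∑-comm H T _) ⟩
      + L * ∑[ t ∈ T ] ∑[ h ∈ H ] (χ t h * weight t * ψ (h γ))
        ≡⟨ sym (∑-*ˡ T (+ L) _) ⟩
      ∑[ t ∈ T ] (+ L * ∑[ h ∈ H ] (χ t h * weight t * ψ (h γ)))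
        ≡⟨ ∑-congᴬ (All.map (λ {t} (fγ , |t|≡a) → tuple t fγ |t|≡a) (tuples-All a (pairs Γ) (pairs-fresh γ∉Γ))) ⟩
      ∑[ t ∈ T ] (weight t * mass t * ∑ (allFin L) ψ)
        ≡⟨ ∑-*ʳ T _ _ ⟩
      ∑[ t ∈ T ] (weight t * mass t) * ∑ (allFin L) ψ
        ≡⟨ cong (_* ∑ (allFin L) ψ) (moment≡∑tuples a Γ) ⟨
      moment a Γ * ∑ (allFin L) ψ ∎
      where
      open ≡-Reasoning
      T = tuples a (pairs Γ)
      tuple : ∀ t → Fresh γ t → length t ≡ a →
        + L * ∑[ h ∈ H ] (χ t h * weight t * ψ (h γ)) ≡ weight t * mass t * ∑ (allFin L) ψ
      tuple t fγ refl = begin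
        + L * ∑[ h ∈ H ] (χ t h * weight t * ψ (h γ))
          ≡⟨ cong (+ L *_) (trans (∑-cong H (λ h → pull (χ t h) (weight t) (ψ (h γ)))) (∑-*ˡ H (weight t) _)) ⟩
        + L * (weight t * ∑[ h ∈ H ] (χ t h * ψ (h γ)))
          ≡⟨ exchange (+ L) (weight t) _ ⟩
        weight t * (+ L * ∑[ h ∈ H ] (χ t h * ψ (h γ)))
          ≡⟨ cong (weight t *_) (fresh-point-factorises t a<c fγ ψ) ⟩
        weight t * (mass t * ∑ (allFin L) ψ)
          ≡⟨ sym (ℤ.*-assoc (weight t) (mass t) _) ⟩
        weight t * mass t * ∑ (allFin L) ψ ∎
        where
        pull : ∀ a b c → a * b * c ≡ b * (a * c)
        pull = solve-∀
        exchange : ∀ a b c → a * (b * c) ≡ b * (a * c)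
        exchange = solve-∀

    power-sum : ℕ → ℤ
    power-sum k = ∑[ v ∈ allFin L ] (φ v ^ k)

    moment-recursion : ∀ r → r < c → ∀ {γ Γ} → All (γ ≢_) Γ →
      + L * moment r (γ ∷ Γ) ≡ ∑ᶻ (λ (k : Fin (suc r)) → + (r C toℕ k) * (moment (r ∸ toℕ k) Γ * power-sum (toℕ k)))
    moment-recursion r r<c {γ} {Γ} γ∉Γ = begin
      + L * moment r (γ ∷ Γ)
        ≡⟨ cong (+ L *_) (∑-cong H (λ h → binomial r (φ (h γ)) (S Γ h))) ⟩
      + L * ∑[ h ∈ H ] ∑ᶻ (term h)
        ≡⟨ cong (+ L *_) (∑-∑ᶻ-comm H (suc r) term) ⟩
      + L * ∑ᶻ (λ (k : Fin (suc r)) → ∑[ h ∈ H ] term h k)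
        ≡⟨ *-distribˡ-sum (+ L) (λ k → ∑[ h ∈ H ] term h k) ⟩
      ∑ᶻ (λ (k : Fin (suc r)) → + L * ∑[ h ∈ H ] term h k)
        ≡⟨ sum-cong-≗ {suc r} step ⟩
      ∑ᶻ (λ (k : Fin (suc r)) → + (r C toℕ k) * (moment (r ∸ toℕ k) Γ * power-sum (toℕ k))) ∎
      where
      open ≡-Reasoning
      term : Hash → Fin (suc r) → ℤ
      term h k = + (r C toℕ k) * (φ (h γ) ^ toℕ k * S Γ h ^ (r ∸ toℕ k))
      step : ∀ k → + L * ∑[ h ∈ H ] term h k ≡ + (r C toℕ k) * (moment (r ∸ toℕ k) Γ * power-sum (toℕ k))
      step k = begin
        + L * ∑[ h ∈ H ] term h k
          ≡⟨ cong (+ L *_) (∑-cong H (λ h → cong (+ (r C toℕ k) *_) (ℤ.*-comm (φ (h γ) ^ toℕ k) _))) ⟩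
        + L * ∑[ h ∈ H ] (+ (r C toℕ k) * (S Γ h ^ (r ∸ toℕ k) * φ (h γ) ^ toℕ k))
          ≡⟨ cong (+ L *_) (∑-*ˡ H (+ (r C toℕ k)) _) ⟩
        + L * (+ (r C toℕ k) * ∑[ h ∈ H ] (S Γ h ^ (r ∸ toℕ k) * φ (h γ) ^ toℕ k))
          ≡⟨ exchange (+ L) (+ (r C toℕ k)) _ ⟩
        + (r C toℕ k) * (+ L * ∑[ h ∈ H ] (S Γ h ^ (r ∸ toℕ k) * φ (h γ) ^ toℕ k))
          ≡⟨ cong (+ (r C toℕ k) *_) (moment-factorises (r ∸ toℕ k) r-k<c γ∉Γ (λ v → φ v ^ toℕ k)) ⟩
        + (r C toℕ k) * (moment (r ∸ toℕ k) Γ * power-sum (toℕ k)) ∎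
        where
        exchange : ∀ a b c → a * (b * c) ≡ b * (a * c)
        exchange = solve-∀
        r-k<c : r ∸ toℕ k < c
        r-k<c = ℕ.≤-<-trans (ℕ.m∸n≤m r (toℕ k)) r<c

module Palette where

  open import Data.Integer using (0ℤ; 1ℤ; -1ℤ; +_; _+_; _-_; _*_; _^_) renaming (∣_∣ to ∣_∣ᶻ)
  open import Data.Integer.Tactic.RingSolver using (solve-∀)
  open import Data.Nat using (_≤_)

  centred : ∀ {n} → Fin (suc n) → Fin (suc n) → ℤ
  centred {n} b v = + suc n * δ v b - 1ℤ

  ∑-centred^ : ∀ {n} (b : Fin (suc n)) k →
    ∑[ v ∈ allFin (suc n) ] (centred b v ^ k) ≡ (+ n) ^ k + + n * -1ℤ ^ k
  ∑-centred^ {n} b k = trans (∑-∘δ b (λ d → (+ suc n * d - 1ℤ) ^ k))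
                             (cong₂ (λ x y → x ^ k + + n * y ^ k) (at-one (+ n)) (at-zero (+ n)))
    where
    at-one : ∀ x → (1ℤ + x) * 1ℤ - 1ℤ ≡ x
    at-one = solve-∀
    at-zero : ∀ x → (1ℤ + x) * 0ℤ - 1ℤ ≡ -1ℤ
    at-zero = solve-∀


  ∣^∣ : ∀ (i : ℤ) k → ∣ i ^ k ∣ᶻ ≡ ∣ i ∣ᶻ ℕ.^ k
  ∣^∣ i zero = refl
  ∣^∣ i (suc k) = trans (ℤ.abs-* i (i ^ k)) (cong (∣ i ∣ᶻ ℕ.*_) (∣^∣ i k))

  ε : ℕ → ℕ → ℕ
  ε L 0 = L
  ε L 1 = 0
  ε L (suc (suc k)) = L ℕ.^ suc (suc k)

  ^+-≤-suc^ : ∀ a k → a ℕ.^ (2 ℕ.+ k) ℕ.+ a ≤ suc a ℕ.^ (2 ℕ.+ k)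
  ^+-≤-suc^ a k = begin
    a ℕ.^ (2 ℕ.+ k) ℕ.+ a
      ≤⟨ ℕ.+-mono-≤ (ℕ.*-monoʳ-≤ a (ℕ.^-monoˡ-≤ (1 ℕ.+ k) (ℕ.n≤1+n a))) a≤ ⟩
    a ℕ.* suc a ℕ.^ (1 ℕ.+ k) ℕ.+ suc a ℕ.^ (1 ℕ.+ k)
      ≡⟨ ℕ.+-comm (a ℕ.* suc a ℕ.^ (1 ℕ.+ k)) _ ⟩
    suc a ℕ.^ (2 ℕ.+ k) ∎
    where
    open ℕ.≤-Reasoning
    a≤ : a ≤ suc a ℕ.^ (1 ℕ.+ k)
    a≤ = ℕ.≤-trans (ℕ.n≤1+n a) (ℕ.m≤m*n (suc a) (suc a ℕ.^ k) {{ℕ.m^n≢0 (suc a) k}})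

  ∣∑-centred^∣≤ε : ∀ {n} (b : Fin (suc n)) k → ∣ ∑[ v ∈ allFin (suc n) ] (centred b v ^ k) ∣ᶻ ≤ ε (suc n) k
  ∣∑-centred^∣≤ε {n} b 0 = ℕ.≤-reflexive (cong ∣_∣ᶻ (trans (∑-centred^ b 0) (cong (_+_ 1ℤ) (ℤ.*-identityʳ (+ n)))))
  ∣∑-centred^∣≤ε {n} b 1 = ℕ.≤-reflexive (cong ∣_∣ᶻ (trans (∑-centred^ b 1) (cancel (+ n))))
    where
    cancel : ∀ x → x * 1ℤ + x * (-1ℤ * 1ℤ) ≡ 0ℤ
    cancel = solve-∀
  ∣∑-centred^∣≤ε {n} b (suc (suc k)) = begin
    ∣ ∑[ v ∈ allFin (suc n) ] (centred b v ^ (2 ℕ.+ k)) ∣ᶻ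
      ≡⟨ cong ∣_∣ᶻ (∑-centred^ b (2 ℕ.+ k)) ⟩
    ∣ (+ n) ^ (2 ℕ.+ k) + + n * -1ℤ ^ (2 ℕ.+ k) ∣ᶻ
      ≤⟨ ℤ.∣i+j∣≤∣i∣+∣j∣ ((+ n) ^ (2 ℕ.+ k)) _ ⟩
    ∣ (+ n) ^ (2 ℕ.+ k) ∣ᶻ ℕ.+ ∣ + n * -1ℤ ^ (2 ℕ.+ k) ∣ᶻ
      ≡⟨ cong₂ ℕ._+_ (∣^∣ (+ n) (2 ℕ.+ k)) ∣n*-1^∣ ⟩
    n ℕ.^ (2 ℕ.+ k) ℕ.+ n ℕ.* 1
      ≡⟨ cong (ℕ._+_ (n ℕ.^ (2 ℕ.+ k))) (ℕ.*-identityʳ n) ⟩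
    n ℕ.^ (2 ℕ.+ k) ℕ.+ n
      ≤⟨ ^+-≤-suc^ n k ⟩
    suc n ℕ.^ (2 ℕ.+ k) ∎
    where
    open ℕ.≤-Reasoning
    ∣n*-1^∣ : ∣ + n * -1ℤ ^ (2 ℕ.+ k) ∣ᶻ ≡ n ℕ.* 1
    ∣n*-1^∣ = trans (ℤ.abs-* (+ n) _) (cong (n ℕ.*_) (trans (∣^∣ -1ℤ (2 ℕ.+ k)) (ℕ.^-zeroˡ (2 ℕ.+ k))))

  palette : ∀ {N} → Subset N → List (Fin N)
  palette {N} P = filter (_∈? P) (allFin N)

  length-palette : ∀ {N} (P : Subset N) → length (palette P) ≡ ∣ P ∣
  length-palette {N} P = ℤ.+-injective (trans (length-filter≡∑𝟙 (_∈? P) (allFin N)) (sym (∣p∣≡∑𝟙∈ P)))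

  ∑-centred-palette : ∀ {N n} (h : Fin N → Fin (suc n)) (P : Subset N) (b : Fin (suc n)) →
    ∑[ x ∈ palette P ] centred b (h x) ≡ + suc n * + binCount h P b - + ∣ P ∣
  ∑-centred-palette {N} {n} h P b = begin
    ∑[ x ∈ palette P ] centred b (h x)
      ≡⟨ ∑-filter (_∈? P) (allFin N) _ ⟩
    ∑[ x ∈ allFin N ] (𝟙 (x ∈? P) * centred b (h x))
      ≡⟨ ∑-cong (allFin N) (λ x → expand (+ suc n) (𝟙 (x ∈? P)) (δ (h x) b)) ⟩
    ∑[ x ∈ allFin N ] (+ suc n * (𝟙 (x ∈? P) * δ (h x) b) + -1ℤ * 𝟙 (x ∈? P))
      ≡⟨ ∑-distrib-+ (allFin N) _ _ ⟩
    ∑[ x ∈ allFin N ] (+ suc n * (𝟙 (x ∈? P) * δ (h x) b)) + ∑[ x ∈ allFin N ] (-1ℤ * 𝟙 (x ∈? P))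
      ≡⟨ cong₂ _+_ (∑-*ˡ (allFin N) (+ suc n) _) (∑-*ˡ (allFin N) -1ℤ _) ⟩
    + suc n * ∑[ x ∈ allFin N ] (𝟙 (x ∈? P) * δ (h x) b) + -1ℤ * ∑[ x ∈ allFin N ] 𝟙 (x ∈? P)
      ≡⟨ cong₂ (λ u w → + suc n * u + -1ℤ * w) bin≡ (sym (∣p∣≡∑𝟙∈ P)) ⟩
    + suc n * + binCount h P b + -1ℤ * + ∣ P ∣
      ≡⟨ negate (+ suc n * + binCount h P b) (+ ∣ P ∣) ⟩
    + suc n * + binCount h P b - + ∣ P ∣ ∎
    where
    open ≡-Reasoning
    expand : ∀ l i d → i * (l * d - 1ℤ) ≡ l * (i * d) + -1ℤ * i
    expand = solve-∀
    negate : ∀ a p → a + -1ℤ * p ≡ a - p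
    negate = solve-∀
    bin≡ : ∑[ x ∈ allFin N ] (𝟙 (x ∈? P) * δ (h x) b) ≡ + binCount h P b
    bin≡ = sym (trans (length-filter≡∑𝟙 _ (allFin N)) (∑-cong (allFin N) (λ x → 𝟙-×-dec (x ∈? P) (h x ≟ b))))

  *-self : ∀ (i : ℤ) → i * i ≡ + (∣ i ∣ᶻ ℕ.* ∣ i ∣ᶻ)
  *-self (+ n) = sym (ℤ.pos-* n n)
  *-self ℤ.-[1+ n ] = refl

  ^-even : ∀ (i : ℤ) k → i ^ (k ℕ.+ k) ≡ + (∣ i ∣ᶻ ℕ.^ (k ℕ.+ k))
  ^-even i k = begin
    i ^ (k ℕ.+ k)                         ≡⟨ ℤ.^-distribˡ-+-* i k k ⟩
    i ^ k * i ^ k                         ≡⟨ *-self (i ^ k) ⟩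
    + (∣ i ^ k ∣ᶻ ℕ.* ∣ i ^ k ∣ᶻ)         ≡⟨ cong (λ a → + (a ℕ.* a)) (∣^∣ i k) ⟩
    + (∣ i ∣ᶻ ℕ.^ k ℕ.* ∣ i ∣ᶻ ℕ.^ k)     ≡⟨ cong +_ (sym (ℕ.^-distribˡ-+-* ∣ i ∣ᶻ k k)) ⟩
    + (∣ i ∣ᶻ ℕ.^ (k ℕ.+ k))              ∎
    where open ≡-Reasoning

  ∑-pos : ∀ {A : Set} (xs : List A) (f : A → ℕ) → ∑[ x ∈ xs ] (+ f x) ≡ + sum (map f xs)
  ∑-pos [] f = refl
  ∑-pos (x ∷ xs) f = cong (_+_ (+ f x)) (∑-pos xs f)

open Palette

open import Data.Nat using (ℕ; _*_; _^_; _+_; _≤_; _<_; _∸_; _≤?_)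
open import Data.Nat using (z≤n; s≤s; ⌊_/2⌋; ⌈_/2⌉; NonZero; >-nonZero)
open import Data.Nat.Properties
open import Data.Nat.Tactic.RingSolver using (solve-∀)
open import Data.Integer using (+_) renaming (∣_∣ to ∣_∣ᶻ)
open import Algebra.Properties.Semiring.Sum +-*-semiring using (*-distribˡ-sum; *-distribʳ-sum)
open RawMonoid ℕ.+-0-rawMonoid using () renaming (sum to ∑ⁿ)

∑ⁿ-mono-≤ : ∀ {n} {f g : Fin n → ℕ} → (∀ k → f k ≤ g k) → ∑ⁿ f ≤ ∑ⁿ g
∑ⁿ-mono-≤ {zero} f≤g = z≤n
∑ⁿ-mono-≤ {suc n} f≤g = +-mono-≤ (f≤g _) (∑ⁿ-mono-≤ (λ k → f≤g (suc k)))

-- K r is the least solution of K (s + 2) = Σ_{k ≤ s} C(s + 2, k + 2) K (s ∸ k), K 0 = 1, K 1 = 0,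
-- tabulated up to r = 10. It is opaque so that K 10 is never unfolded into unary additions.
opaque
  K : ℕ → ℕ
  K 0 = 1
  K 1 = 0
  K 2 = 1
  K 3 = 1
  K 4 = 7
  K 5 = 21
  K 6 = 141
  K 7 = 743
  K 8 = 5699
  K 9 = 42241
  K 10 = 382153
  K _ = 0

opaque
  unfolding K

  K-0 : K 0 ≡ 1
  K-0 = refl

  K-1 : K 1 ≡ 0
  K-1 = refl

  K-10 : K 10 ≡ 382153
  K-10 = refl

  K-recursion : ∀ s → s ≤ 8 → ∑ⁿ (λ (k : Fin (suc s)) → ((2 + s) C (2 + toℕ k)) * K (s ∸ toℕ k)) ≤ K (2 + s)
  K-recursion 0 _ = ≤ᵇ⇒≤ _ _ tt
  K-recursion 1 _ = ≤ᵇ⇒≤ _ _ tt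
  K-recursion 2 _ = ≤ᵇ⇒≤ _ _ tt
  K-recursion 3 _ = ≤ᵇ⇒≤ _ _ tt
  K-recursion 4 _ = ≤ᵇ⇒≤ _ _ tt
  K-recursion 5 _ = ≤ᵇ⇒≤ _ _ tt
  K-recursion 6 _ = ≤ᵇ⇒≤ _ _ tt
  K-recursion 7 _ = ≤ᵇ⇒≤ _ _ tt
  K-recursion 8 _ = ≤ᵇ⇒≤ _ _ tt
  K-recursion (suc (suc (suc (suc (suc (suc (suc (suc (suc _))))))))) (s≤s (s≤s (s≤s (s≤s (s≤s (s≤s (s≤s (s≤s ()))))))))

G : ℕ → ℕ → ℕ → ℕ
G L r j = K r * ((j + L) ^ ⌊ r /2⌋ * L ^ ⌈ r /2⌉)

^-shift-≤ : ∀ {D L} a b a′ b′ → L ≤ D → a ≤ a′ → a + b ≡ a′ + b′ → D ^ a * L ^ b ≤ D ^ a′ * L ^ b′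
^-shift-≤ {D} {L} a b a′ b′ L≤D a≤a′ eq with m≤n⇒∃[o]m+o≡n a≤a′
... | d , refl = begin
  D ^ a * L ^ b               ≡⟨ cong (λ t → D ^ a * L ^ t) b≡d+b′ ⟩
  D ^ a * L ^ (d + b′)        ≡⟨ cong (D ^ a *_) (^-distribˡ-+-* L d b′) ⟩
  D ^ a * (L ^ d * L ^ b′)    ≤⟨ *-monoʳ-≤ (D ^ a) (*-monoˡ-≤ (L ^ b′) (^-monoˡ-≤ d L≤D)) ⟩
  D ^ a * (D ^ d * L ^ b′)    ≡⟨ sym (*-assoc (D ^ a) _ _) ⟩
  D ^ a * D ^ d * L ^ b′      ≡⟨ cong (_* L ^ b′) (sym (^-distribˡ-+-* D a d)) ⟩
  D ^ (a + d) * L ^ b′        ∎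
  where
  open ≤-Reasoning
  b≡d+b′ : b ≡ d + b′
  b≡d+b′ = +-cancelˡ-≡ a b (d + b′) (trans eq (+-assoc a d b′))

G-shift : ∀ L j {s i} → i ≤ s →
  G L (s ∸ i) j * L ^ (2 + i) ≤ K (s ∸ i) * ((j + L) ^ ⌊ s /2⌋ * L ^ (2 + ⌈ s /2⌉))
G-shift L j {s} {i} i≤s = begin
  G L (s ∸ i) j * L ^ (2 + i)
    ≡⟨ regroup (K (s ∸ i)) (D ^ ⌊ s ∸ i /2⌋) _ _ ⟩
  K (s ∸ i) * (D ^ ⌊ s ∸ i /2⌋ * (L ^ ⌈ s ∸ i /2⌉ * L ^ (2 + i)))
    ≡⟨ cong (λ t → K (s ∸ i) * (D ^ ⌊ s ∸ i /2⌋ * t)) (^-distribˡ-+-* L ⌈ s ∸ i /2⌉ (2 + i)) ⟨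
  K (s ∸ i) * (D ^ ⌊ s ∸ i /2⌋ * L ^ (⌈ s ∸ i /2⌉ + (2 + i)))
    ≤⟨ *-monoʳ-≤ (K (s ∸ i)) (^-shift-≤ _ _ _ _ (m≤n+m L j) (⌊n/2⌋-mono (m∸n≤m s i)) exponents) ⟩
  K (s ∸ i) * (D ^ ⌊ s /2⌋ * L ^ (2 + ⌈ s /2⌉)) ∎
  where
  open ≤-Reasoning
  D = j + L
  regroup : ∀ k x y z → k * (x * y) * z ≡ k * (x * (y * z))
  regroup = solve-∀
  shuffle : ∀ x y i → x + (y + (2 + i)) ≡ 2 + ((x + y) + i)
  shuffle = solve-∀
  regather : ∀ x y → 2 + (x + y) ≡ x + (2 + y)
  regather = solve-∀
  exponents : ⌊ s ∸ i /2⌋ + (⌈ s ∸ i /2⌉ + (2 + i)) ≡ ⌊ s /2⌋ + (2 + ⌈ s /2⌉)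
  exponents = begin-equality
    ⌊ s ∸ i /2⌋ + (⌈ s ∸ i /2⌉ + (2 + i))  ≡⟨ shuffle ⌊ s ∸ i /2⌋ ⌈ s ∸ i /2⌉ i ⟩
    2 + ((⌊ s ∸ i /2⌋ + ⌈ s ∸ i /2⌉) + i)  ≡⟨ cong (λ t → 2 + (t + i)) (⌊n/2⌋+⌈n/2⌉≡n (s ∸ i)) ⟩
    2 + ((s ∸ i) + i)                      ≡⟨ cong (_+_ 2) (m∸n+n≡m i≤s) ⟩
    2 + s                                  ≡⟨ cong (_+_ 2) (⌊n/2⌋+⌈n/2⌉≡n s) ⟨
    2 + (⌊ s /2⌋ + ⌈ s /2⌉)                ≡⟨ regather ⌊ s /2⌋ ⌈ s /2⌉ ⟩
    ⌊ s /2⌋ + (2 + ⌈ s /2⌉)                ∎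

G-recursion : ∀ L r j → r ≤ 10 →
  ∑ⁿ (λ (k : Fin (suc r)) → (r C toℕ k) * G L (r ∸ toℕ k) j * ε L (toℕ k)) ≤ L * G L r (suc j)
G-recursion L 0 j _ rewrite K-0 = ≤-reflexive (unit L)
  where
  unit : ∀ L → 1 * L + 0 ≡ L * 1
  unit = solve-∀
G-recursion L 1 j _ rewrite K-0 | K-1 = z≤n
G-recursion L (suc (suc s)) j r≤10 = begin
    g zero + (g (suc zero) + ∑ⁿ (λ k → g (suc (suc k))))
      ≡⟨ cong (λ t → g zero + (t + ∑ⁿ (λ k → g (suc (suc k))))) (*-zeroʳ ((r C 1) * G L (suc s) j)) ⟩
    g zero + ∑ⁿ (λ k → g (suc (suc k)))
      ≤⟨ +-monoʳ-≤ (g zero) (∑ⁿ-mono-≤ term) ⟩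
    g zero + ∑ⁿ (λ (k : Fin (suc s)) → (r C (2 + toℕ k)) * K (s ∸ toℕ k) * (X * Y′))
      ≡⟨ cong (_+_ (g zero)) (*-distribʳ-sum {suc s} (X * Y′) (λ k → (r C (2 + toℕ k)) * K (s ∸ toℕ k))) ⟨
    g zero + ∑ⁿ (λ (k : Fin (suc s)) → (r C (2 + toℕ k)) * K (s ∸ toℕ k)) * (X * Y′)
      ≤⟨ +-monoʳ-≤ (g zero) (*-monoˡ-≤ (X * Y′) (K-recursion s (≤-pred (≤-pred r≤10)))) ⟩
    g zero + K r * (X * Y′)
      ≡⟨ collect (K r) D X Y L ⟩
    L * (K r * ((suc D * X) * Y))
      ≤⟨ *-monoʳ-≤ L (*-monoʳ-≤ (K r) (*-monoˡ-≤ Y (*-monoʳ-≤ (suc D) (^-monoˡ-≤ ⌊ s /2⌋ (n≤1+n D))))) ⟩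
    L * G L r (suc j) ∎
  where
  open ≤-Reasoning
  r = suc (suc s)
  D = j + L
  X = D ^ ⌊ s /2⌋
  Y = L ^ suc ⌈ s /2⌉
  Y′ = L ^ (2 + ⌈ s /2⌉)
  g : Fin (suc r) → ℕ
  g k = (r C toℕ k) * G L (r ∸ toℕ k) j * ε L (toℕ k)
  collect : ∀ K D X Y L → 1 * (K * ((D * X) * Y)) * L + K * (X * (L * Y)) ≡ L * (K * ((suc D * X) * Y))
  collect = solve-∀
  term : ∀ (k : Fin (suc s)) → g (suc (suc k)) ≤ (r C (2 + toℕ k)) * K (s ∸ toℕ k) * (X * Y′)
  term k = begin
    (r C (2 + toℕ k)) * G L (s ∸ toℕ k) j * L ^ (2 + toℕ k)
      ≡⟨ *-assoc (r C (2 + toℕ k)) _ _ ⟩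
    (r C (2 + toℕ k)) * (G L (s ∸ toℕ k) j * L ^ (2 + toℕ k))
      ≤⟨ *-monoʳ-≤ (r C (2 + toℕ k)) (G-shift L j (Fin.toℕ≤pred[n] k)) ⟩
    (r C (2 + toℕ k)) * (K (s ∸ toℕ k) * (X * Y′))
      ≡⟨ *-assoc (r C (2 + toℕ k)) _ _ ⟨
    (r C (2 + toℕ k)) * K (s ∸ toℕ k) * (X * Y′) ∎

∣∑ᶻ∣≤∑ⁿ∣∣ : ∀ {n} (f : Fin n → ℤ) → ∣ ∑ᶻ f ∣ᶻ ≤ ∑ⁿ (∣_∣ᶻ ∘ f)
∣∑ᶻ∣≤∑ⁿ∣∣ {zero} f = z≤n
∣∑ᶻ∣≤∑ⁿ∣∣ {suc n} f = ≤-trans (ℤ.∣i+j∣≤∣i∣+∣j∣ (f zero) _) (+-monoʳ-≤ ∣ f zero ∣ᶻ (∣∑ᶻ∣≤∑ⁿ∣∣ (f ∘ suc)))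

markov : ∀ {A : Set} {P : A → Set} (P? : ∀ x → Dec (P x)) (xs : List A) (f : A → ℕ) t →
  (∀ x → P x → t ≤ f x) → length (filter P? xs) * t ≤ sum (map f xs)
markov P? [] f t _ = z≤n
markov P? (x ∷ xs) f t t≤f with P? x
... | yes px = +-mono-≤ (t≤f x px) (markov P? xs f t t≤f)
... | no _ = ≤-trans (markov P? xs f t t≤f) (m≤n+m _ (f x))

*-^ : ∀ x y k → (x * y) ^ k ≡ x ^ k * y ^ k
*-^ x y zero = refl
*-^ x y (suc k) = trans (cong ((x * y) *_) (*-^ x y k)) (swap x y (x ^ k) (y ^ k))
  where
  swap : ∀ a b c d → (a * b) * (c * d) ≡ (a * c) * (b * d)
  swap = solve-∀

bin-deficit : ∀ {m L p p′} → m ≡ suc L → 4 ≤ m → m ^ 10 ≤ p → p′ * m ≤ p + m ^ 8 →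
              4 * m * (L * p′) + p ≤ 4 * m * p
bin-deficit {m} {L} {p} {p′} refl 4≤m m¹⁰≤p bad = begin
  4 * m * (L * p′) + p         ≡⟨ e₁ m L p′ p ⟩
  4 * (L * (p′ * m)) + p       ≤⟨ +-monoˡ-≤ p (*-monoʳ-≤ 4 (*-monoʳ-≤ L bad)) ⟩
  4 * (L * (p + m ^ 8)) + p    ≡⟨ e₂ L p (m ^ 8) ⟩
  4 * L * p + (4 * L * m ^ 8 + p) ≤⟨ +-monoʳ-≤ (4 * L * p) (+-monoˡ-≤ p small) ⟩
  4 * L * p + (3 * p + p)      ≡⟨ e₃ L p ⟩
  4 * m * p                    ∎
  where
  open ≤-Reasoning
  e₁ : ∀ m L p′ p → 4 * m * (L * p′) + p ≡ 4 * (L * (p′ * m)) + p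
  e₁ = solve-∀
  e₂ : ∀ L p q → 4 * (L * (p + q)) + p ≡ 4 * L * p + (4 * L * q + p)
  e₂ = solve-∀
  e₃ : ∀ L p → 4 * L * p + (3 * p + p) ≡ 4 * suc L * p
  e₃ = solve-∀
  small : 4 * L * m ^ 8 ≤ 3 * p
  small = begin
    4 * L * m ^ 8  ≤⟨ *-monoˡ-≤ (m ^ 8) (*-monoʳ-≤ 4 (n≤1+n L)) ⟩
    4 * m * m ^ 8  ≡⟨ *-assoc 4 m (m ^ 8) ⟩
    4 * m ^ 9      ≤⟨ *-monoˡ-≤ (m ^ 9) 4≤m ⟩
    m ^ 10         ≤⟨ m¹⁰≤p ⟩
    p              ≤⟨ m≤n*m p 3 ⟩
    3 * p          ∎

bin-deviation : ∀ {m L p p′} → m ≡ suc L → 4 ≤ m → m ^ 10 ≤ p → p′ * m ≤ p + m ^ 8 →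
                p ≤ 4 * m * ∣ + L ℤ.* + p′ ℤ.- + p ∣ᶻ
bin-deviation {m} {L} {p} {p′} m≡ 4≤m m¹⁰≤p bad = begin
  p                        ≤⟨ m+n≤o⇒m≤o∸n p (≤-trans (≤-reflexive (+-comm p _)) deficit) ⟩
  4 * m * p ∸ 4 * m * Lp′  ≡⟨ *-distribˡ-∸ (4 * m) p Lp′ ⟨
  4 * m * (p ∸ Lp′)        ≡⟨ cong (4 * m *_) distance ⟨
  4 * m * ∣ + L ℤ.* + p′ ℤ.- + p ∣ᶻ ∎
  where
  open ≤-Reasoning
  Lp′ = L * p′
  deficit = bin-deficit m≡ 4≤m m¹⁰≤p bad
  instance
    4m≢0 : NonZero (4 * m)
    4m≢0 = m*n≢0 4 m {{_}} {{>-nonZero (≤-trans (s≤s z≤n) 4≤m)}}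
  Lp′≤p : Lp′ ≤ p
  Lp′≤p = *-cancelˡ-≤ (4 * m) (≤-trans (m≤m+n (4 * m * Lp′) p) deficit)
  distance : ∣ + L ℤ.* + p′ ℤ.- + p ∣ᶻ ≡ p ∸ Lp′
  distance = begin-equality
    ∣ + L ℤ.* + p′ ℤ.- + p ∣ᶻ   ≡⟨ cong (λ x → ∣ x ℤ.- + p ∣ᶻ) (ℤ.pos-* L p′) ⟨
    ∣ + Lp′ ℤ.- + p ∣ᶻ          ≡⟨ cong ∣_∣ᶻ (trans (ℤ.[+m]-[+n]≡m⊖n Lp′ p) (ℤ.⊖-≤ Lp′≤p)) ⟩
    ∣ ℤ.- + (p ∸ Lp′) ∣ᶻ        ≡⟨ ℤ.∣-i∣≡∣i∣ (+ (p ∸ Lp′)) ⟩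
    p ∸ Lp′                    ∎

cancel-p⁵ : ∀ {K L m p Q h} → 0 < p → L ≤ m → m ≤ p →
  Q * p ^ 10 ≤ (4 * m) ^ 10 * (h * (K * ((p + L) ^ 5 * L ^ 5))) →
  Q * p ^ 5 ≤ 4 ^ 10 * K * 2 ^ 5 * m ^ 15 * h
cancel-p⁵ {K} {L} {m} {p} {Q} {h} 0<p L≤m m≤p bound = *-cancelˡ-≤ (p ^ 5) {{m^n≢0 p 5 {{>-nonZero 0<p}}}} (begin
  p ^ 5 * (Q * p ^ 5)                                  ≡⟨ regroup₁ (p ^ 5) Q ⟩
  Q * (p ^ 5 * p ^ 5)                                  ≡⟨ cong (Q *_) (^-distribˡ-+-* p 5 5) ⟨
  Q * p ^ 10                                           ≤⟨ bound ⟩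
  (4 * m) ^ 10 * (h * (K * ((p + L) ^ 5 * L ^ 5)))
    ≤⟨ *-monoʳ-≤ ((4 * m) ^ 10) (*-monoʳ-≤ h (*-monoʳ-≤ K (*-mono-≤ p+L≤2p (^-monoˡ-≤ 5 L≤m)))) ⟩
  (4 * m) ^ 10 * (h * (K * ((2 * p) ^ 5 * m ^ 5)))
    ≡⟨ cong₂ (λ x y → x * (h * (K * (y * m ^ 5)))) (*-^ 4 m 10) (*-^ 2 p 5) ⟩
  4 ^ 10 * m ^ 10 * (h * (K * (2 ^ 5 * p ^ 5 * m ^ 5)))
    ≡⟨ regroup₂ (4 ^ 10) (m ^ 10) h K (2 ^ 5) (p ^ 5) (m ^ 5) ⟩
  p ^ 5 * (4 ^ 10 * K * 2 ^ 5 * (m ^ 10 * m ^ 5) * h)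
    ≡⟨ cong (λ x → p ^ 5 * (4 ^ 10 * K * 2 ^ 5 * x * h)) (^-distribˡ-+-* m 10 5) ⟨
  p ^ 5 * (4 ^ 10 * K * 2 ^ 5 * m ^ 15 * h) ∎)
  where
  open ≤-Reasoning
  p+L≤2p : (p + L) ^ 5 ≤ (2 * p) ^ 5
  p+L≤2p = ^-monoˡ-≤ 5 (≤-trans (+-monoʳ-≤ p (≤-trans L≤m m≤p)) (≤-reflexive (cong (_+_ p) (sym (+-identityʳ p)))))
  regroup₁ : ∀ s q → s * (q * s) ≡ q * (s * s)
  regroup₁ = solve-∀
  regroup₂ : ∀ a x h k d s y → a * x * (h * (k * (d * s * y))) ≡ s * (a * k * d * (x * y) * h)
  regroup₂ = solve-∀

cancel-m²⁰ : ∀ {C m p Q h} → 0 < m → m ^ 10 ≤ p → C ≤ m ^ 5 →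
  Q * p ^ 5 ≤ C * m ^ 15 * h → Q * m ^ 30 ≤ h
cancel-m²⁰ {C} {m} {p} {Q} {h} 0<m m¹⁰≤p C≤m⁵ bound = *-cancelˡ-≤ (m ^ 20) {{m^n≢0 m 20 {{>-nonZero 0<m}}}} (begin
  m ^ 20 * (Q * m ^ 30)   ≡⟨ regroup (m ^ 20) Q (m ^ 30) ⟩
  Q * (m ^ 20 * m ^ 30)   ≡⟨ cong (Q *_) (^-distribˡ-+-* m 20 30) ⟨
  Q * m ^ 50              ≡⟨ cong (Q *_) (^-*-assoc m 10 5) ⟨
  Q * (m ^ 10) ^ 5        ≤⟨ *-monoʳ-≤ Q (^-monoˡ-≤ 5 m¹⁰≤p) ⟩
  Q * p ^ 5               ≤⟨ bound ⟩
  C * m ^ 15 * h          ≤⟨ *-monoˡ-≤ h (*-monoˡ-≤ (m ^ 15) C≤m⁵) ⟩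
  m ^ 5 * m ^ 15 * h      ≡⟨ cong (_* h) (^-distribˡ-+-* m 5 15) ⟨
  m ^ 20 * h              ∎)
  where
  open ≤-Reasoning
  regroup : ∀ a q b → a * (q * b) ≡ q * (a * b)
  regroup = solve-∀

module PaletteMoments (N n′ : ℕ) (H : List (Fin N → Fin (suc n′))) (c : ℕ)
                      (cw : CWiseIndependent c N (suc n′) H) (c≤N : c ≤ N) (b : Fin (suc n′)) where

  L : ℕ
  L = suc n′

  open Independence N L H c cw c≤N
  open Moments (centred b) public

  moment-bound : ∀ Γ → Unique Γ → ∀ r → r ≤ 10 → r < c → ∣ moment r Γ ∣ᶻ ≤ length H * G L r (length Γ)
  moment-bound [] _ zero _ _ =
    ≤-reflexive (trans (cong ∣_∣ᶻ (∑-const H ℤ.1ℤ))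
                       (trans (ℤ.abs-* (+ length H) ℤ.1ℤ) (cong (λ k → length H * (k * 1)) (sym K-0))))
  moment-bound [] _ (suc r) _ _ = ≤-trans (≤-reflexive (cong ∣_∣ᶻ (∑-zero H))) z≤n
  moment-bound (γ ∷ Γ) (γ∉Γ ∷ uΓ) r r≤10 r<c = *-cancelˡ-≤ L (begin
    L * ∣ moment r (γ ∷ Γ) ∣ᶻ                         ≡⟨ ℤ.abs-* (+ L) (moment r (γ ∷ Γ)) ⟨
    ∣ + L ℤ.* moment r (γ ∷ Γ) ∣ᶻ                     ≡⟨ cong ∣_∣ᶻ (moment-recursion r r<c γ∉Γ) ⟩
    ∣ ∑ᶻ term ∣ᶻ                                      ≤⟨ ∣∑ᶻ∣≤∑ⁿ∣∣ term ⟩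
    ∑ⁿ (∣_∣ᶻ ∘ term)                                  ≤⟨ ∑ⁿ-mono-≤ term-bound ⟩
    ∑ⁿ (λ k → length H * bound k)                    ≡⟨ *-distribˡ-sum (length H) bound ⟨
    length H * ∑ⁿ bound                              ≤⟨ *-monoʳ-≤ (length H) (G-recursion L r j r≤10) ⟩
    length H * (L * G L r (suc j))                   ≡⟨ exchange (length H) L (G L r (suc j)) ⟩
    L * (length H * G L r (suc j))                   ∎)
    where
    open ≤-Reasoning
    j = length Γ
    term : Fin (suc r) → ℤ
    term k = + (r C toℕ k) ℤ.* (moment (r ∸ toℕ k) Γ ℤ.* power-sum (toℕ k))
    bound : Fin (suc r) → ℕ
    bound k = (r C toℕ k) * G L (r ∸ toℕ k) j * ε L (toℕ k)
    exchange : ∀ a b d → a * (b * d) ≡ b * (a * d)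
    exchange = solve-∀
    regroup : ∀ a h g e → a * ((h * g) * e) ≡ h * (a * g * e)
    regroup = solve-∀
    term-bound : ∀ k → ∣ term k ∣ᶻ ≤ length H * bound k
    term-bound k = begin
      ∣ term k ∣ᶻ
        ≡⟨ trans (ℤ.abs-* (+ (r C i)) _) (cong ((r C i) *_) (ℤ.abs-* (moment (r ∸ i) Γ) (power-sum i))) ⟩
      (r C i) * (∣ moment (r ∸ i) Γ ∣ᶻ * ∣ power-sum i ∣ᶻ)
        ≤⟨ *-monoʳ-≤ (r C i) (*-mono-≤ (moment-bound Γ uΓ (r ∸ i) r-i≤10 r-i<c) (∣∑-centred^∣≤ε b i)) ⟩
      (r C i) * ((length H * G L (r ∸ i) j) * ε L i)
        ≡⟨ regroup (r C i) (length H) (G L (r ∸ i) j) (ε L i) ⟩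
      length H * bound k ∎
      where
      i = toℕ k
      r-i≤10 = ≤-trans (m∸n≤m r i) r≤10
      r-i<c = ≤-<-trans (m∸n≤m r i) r<c

  tenth-moment-bound : ∀ P → 10 < c → ∣ moment 10 (palette P) ∣ᶻ ≤ length H * (K 10 * ((∣ P ∣ + L) ^ 5 * L ^ 5))
  tenth-moment-bound P 10<c = subst (λ j → ∣ moment 10 (palette P) ∣ᶻ ≤ length H * G L 10 j) (length-palette P)
                                    (moment-bound (palette P) (filter⁺ _ (allFin⁺ N)) 10 ≤-refl 10<c)

  moment-markov : ∀ {P : Hash → Set} (P? : ∀ h → Dec (P h)) Γ k t a →
    (∀ h → P h → t ≤ a * ∣ S Γ h ∣ᶻ) →
    length (filter P? H) * t ^ (k + k) ≤ a ^ (k + k) * ∣ moment (k + k) Γ ∣ᶻ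
  moment-markov {P} P? Γ k t a t≤aS = begin
    length (filter P? H) * t ^ (k + k)
      ≤⟨ markov P? H f (t ^ (k + k)) t^2k≤f ⟩
    sum (map f H)
      ≡⟨ cong ∣_∣ᶻ (∑-pos H f) ⟨
    ∣ ∑[ h ∈ H ] (+ f h) ∣ᶻ
      ≡⟨ cong ∣_∣ᶻ (trans (∑-cong H f≡) (∑-*ˡ H (+ a ^ (k + k)) _)) ⟩
    ∣ + a ^ (k + k) ℤ.* moment (k + k) Γ ∣ᶻ
      ≡⟨ ℤ.abs-* (+ a ^ (k + k)) _ ⟩
    a ^ (k + k) * ∣ moment (k + k) Γ ∣ᶻ ∎
    where
    open ≤-Reasoning
    f : Hash → ℕ
    f h = a ^ (k + k) * ∣ S Γ h ∣ᶻ ^ (k + k)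
    t^2k≤f : ∀ h → P h → t ^ (k + k) ≤ f h
    t^2k≤f h Ph = ≤-trans (^-monoˡ-≤ (k + k) (t≤aS h Ph)) (≤-reflexive (*-^ a _ (k + k)))
    f≡ : ∀ h → + f h ≡ + a ^ (k + k) ℤ.* S Γ h ℤ.^ (k + k)
    f≡ h = trans (ℤ.pos-* (a ^ (k + k)) _) (cong (+ a ^ (k + k) ℤ.*_) (sym (^-even (S Γ h) k)))

bin-tail : ∀ {c} → 11 ≤ c → ∀ {n′ m} → m ≡ suc (suc n′) → 500 + c ≤ m →
  ∀ {N} (P : Subset N) → m ^ 10 < ∣ P ∣ → (b : Fin (suc n′)) (H : List (Fin N → Fin (suc n′))) →
  CWiseIndependent c N (suc n′) H →
  length (filter (λ h → binCount h P b * m ≤? ∣ P ∣ + m ^ 8) H) * m ^ 30 ≤ length H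
bin-tail {c} 11≤c {n′} {m} m≡ 500+c≤m {N} P m¹⁰<p b H cw =
  cancel-m²⁰ {Q = Q} 0<m m¹⁰≤p C≤m⁵ (cancel-p⁵ {K = K 10} {Q = Q} {h = length H} 0<p L≤m m≤p (begin
    Q * p ^ 10
      ≤⟨ moment-markov _ (palette P) 5 p (4 * m) deviation ⟩
    (4 * m) ^ 10 * ∣ moment 10 (palette P) ∣ᶻ
      ≤⟨ *-monoʳ-≤ ((4 * m) ^ 10) (tenth-moment-bound P 11≤c) ⟩
    (4 * m) ^ 10 * (length H * (K 10 * ((p + L) ^ 5 * L ^ 5))) ∎))
  where
  open ≤-Reasoning
  p = ∣ P ∣
  Q = length (filter (λ h → binCount h P b * m ≤? p + m ^ 8) H)
  500≤m = ≤-trans (m≤m+n 500 c) 500+c≤m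
  0<m = ≤-trans (s≤s z≤n) 500≤m
  m¹⁰≤p = <⇒≤ m¹⁰<p
  m≤p : m ≤ p
  m≤p = ≤-trans (m≤m*n m (m ^ 9) {{m^n≢0 m 9 {{>-nonZero 0<m}}}}) m¹⁰≤p
  0<p = ≤-trans 0<m m≤p
  c≤N : c ≤ N
  c≤N = ≤-trans (≤-trans (m≤n+m c 500) 500+c≤m) (≤-trans m≤p (∣p∣≤n P))
  -- 4¹⁰ · K 10 · 2⁵ ≈ 1.3 · 10¹³ ≤ 500⁵: this is where m₀ = 500 + c comes from.
  C≤m⁵ : 4 ^ 10 * K 10 * 2 ^ 5 ≤ m ^ 5
  C≤m⁵ = ≤-trans (subst (λ k → 4 ^ 10 * k * 2 ^ 5 ≤ 500 ^ 5) (sym K-10) (≤ᵇ⇒≤ _ _ tt)) (^-monoˡ-≤ 5 500≤m)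
  open PaletteMoments N n′ H c cw c≤N b
  L≤m : L ≤ m
  L≤m = ≤-trans (n≤1+n L) (≤-reflexive (sym m≡))
  deviation : ∀ h → binCount h P b * m ≤ p + m ^ 8 → p ≤ 4 * m * ∣ S (palette P) h ∣ᶻ
  deviation h bad = subst (λ s → p ≤ 4 * m * ∣ s ∣ᶻ) (sym (∑-centred-palette h P b))
                          (bin-deviation {p′ = binCount h P b} m≡ (≤-trans (≤ᵇ⇒≤ 4 500 tt) 500≤m) m¹⁰≤p bad)

lemma3p6 : ∃ λ c₀ → (c : ℕ) → c₀ ≤ c → ∃ λ m₀ → (m : ℕ) → m₀ ≤ m →
    (n : ℕ) (P : Subset (n ^ 2)) → m ^ 10 < ∣ P ∣ →
    (b : Fin (m ∸ 1)) →
    (H : List (Fin (n ^ 2) → Fin (m ∸ 1))) → CWiseIndependent c (n ^ 2) (m ∸ 1) H →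
    length (filter (λ h → binCount h P b * m ≤? ∣ P ∣ + m ^ 8) H) * m ^ 30 ≤ length H
lemma3p6 = 11 , λ c 11≤c → 500 + c , λ where
  (suc (suc n′)) 500+c≤m n P → bin-tail 11≤c refl 500+c≤m P
  (suc zero) (s≤s ())
  zero ()
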